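{- Let $V_T$ be a set of terminals, $V_N=\{0,1,\dots,n\}$ a finite set of nonterminals, $\Delta$ the set of PEG expressions over $V_T,V_N$, and $P_{exp}:V_N\to\Delta$. Let $\mathbb{F}=\{P\in\mathbb{C}: P=r_0^P\}$. Then for every $P\in\mathbb{F}$ and every $A\in V_N$, $P=\rho(A,P)$.
   Context: PEG expressions $\Delta$ are generated by: $\epsilon$, $[\cdot]$, $[a]$ ($a\in V_T$), $A$ ($A\in V_N$), $e_1;e_2$, $e_1/e_2$, $e*$, $!e$. A property map is $P:V_N\to\{\mathrm{true},\mathrm{false}\}^3$, $\mathbb{P}$ the set of all of them; $P\le P'$ iff for all $A$ and $i\in\{1,2,3\}$, $P(A)_i\Rightarrow P'(A)_i$. Define $g:\Delta\times\mathbb{P}\to\{\mathrm{true},\mathrm{false}\}^3$, $g(e,P)=(\bot(e),z(e),c(e))$, recursively: $g(\epsilon,P)=(\mathrm{false},\mathrm{true},\mathrm{false})$; $g([\cdot],P)=g([a],P)=(\mathrm{true},\mathrm{false},\mathrm{true})$; $g(A,P)=P(A)$; for $e_1;e_2$: $\bot=\bot(e_1)\vee((z(e_1)\vee c(e_1))\wedge\bot(e_2))$, $z=z(e_1)\wedge z(e_2)$, $c=(c(e_1)\wedge(z(e_2)\vee c(e_2)))\vee(z(e_1)\wedge c(e_2))$; for $e_1/e_2$: $\bot=\bot(e_1)\wedge\bot(e_2)$, $z=z(e_1)\vee(\bot(e_1)\wedge z(e_2))$, $c=c(e_1)\vee(\bot(e_1)\wedge c(e_2))$; for $e*$: $(\mathrm{false},\bot(e),c(e))$;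 for $!e$: $(z(e)\vee c(e),\bot(e),\mathrm{false})$. Define $\rho(A,P)\in\mathbb{P}$ by $\rho(A,P)(A)=g(P_{exp}(A),P)$ and $\rho(A,P)(B)=P(B)$ for $B\ne A$. Coherent maps: $\mathbb{C}=\{P\in\mathbb{P}:\forall A\in V_N,\ P\le\rho(A,P)\}$. For $P\in\mathbb{P}$ and $A\in\{0,\dots,n\}$ define $r_n^P=\rho(n,P)$ and, for $A<n$, $r_A^P=r_{A+1}^{\rho(A,P)}$. -}

module Defs where

open import Data.Bool using (Bool; true; false; _∧_; _∨_; T; if_then_else_)
open import Data.Product using (_×_; _,_; proj₁; proj₂)
open import Data.Nat using (ℕ; zero; suc; _∸_; _≡ᵇ_)
open import Data.Fin using (Fin; toℕ)
open import Relation.Binary.PropositionalEquality using (_≡_)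

data Exp (VT : Set) (VN : Set) : Set where
  ε     : Exp VT VN
  any   : Exp VT VN
  term  : VT → Exp VT VN
  nt    : VN → Exp VT VN
  _︔_   : Exp VT VN → Exp VT VN → Exp VT VN
  _／_   : Exp VT VN → Exp VT VN → Exp VT VN
  _⋆    : Exp VT VN → Exp VT VN
  !_    : Exp VT VN → Exp VT VN

Triple : Set
Triple = Bool × Bool × Bool

-- components: ⊥ (fail), z (succeed w/o consuming), c (succeed consuming)
fl zr cn : Triple → Bool
fl t = proj₁ t
zr t = proj₁ (proj₂ t)
cn t = proj₂ (proj₂ t)

PMap : Set → Set
PMap VN = VN → Triple

_≤P_ : {VN : Set} → PMap VN → PMap VN → Set
_≤P_ {VN} P P' = (A : VN) →
  (T (fl (P A)) → T (fl (P' A))) ×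
  (T (zr (P A)) → T (zr (P' A))) ×
  (T (cn (P A)) → T (cn (P' A)))

g : {VT VN : Set} → Exp VT VN → PMap VN → Triple
g ε P = false , true , false
g any P = true , false , true
g (term a) P = true , false , true
g (nt A) P = P A
g (e₁ ︔ e₂) P =
  let t₁ = g e₁ P ; t₂ = g e₂ P in
  (fl t₁ ∨ ((zr t₁ ∨ cn t₁) ∧ fl t₂)) ,
  (zr t₁ ∧ zr t₂) ,
  ((cn t₁ ∧ (zr t₂ ∨ cn t₂)) ∨ (zr t₁ ∧ cn t₂))
g (e₁ ／ e₂) P =
  let t₁ = g e₁ P ; t₂ = g e₂ P in
  (fl t₁ ∧ fl t₂) ,
  (zr t₁ ∨ (fl t₁ ∧ zr t₂)) ,
  (cn t₁ ∨ (fl t₁ ∧ cn t₂))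
g (e ⋆) P = let t = g e P in false , fl t , cn t
g (! e) P = let t = g e P in (zr t ∨ cn t) , fl t , false

module PEG {VT : Set} (n : ℕ) (Pexp : Fin (suc n) → Exp VT (Fin (suc n))) where

  VN : Set
  VN = Fin (suc n)

  ρℕ : ℕ → PMap VN → PMap VN
  ρℕ i P B = if toℕ B ≡ᵇ i then g (Pexp B) P else P B

  ρ : VN → PMap VN → PMap VN
  ρ A P = ρℕ (toℕ A) P

  -- rAux m i P = r_i^P when i + m = n
  rAux : ℕ → ℕ → PMap VN → PMap VN
  rAux zero i P = ρℕ i P
  rAux (suc m) i P = rAux m (suc i) (ρℕ i P)

  -- r_A^P : r_n^P = ρ(n,P), r_A^P = r_{A+1}^{ρ(A,P)} for A < n
  r : VN → PMap VN → PMap VN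
  r A P = rAux (n ∸ toℕ A) (toℕ A) P

  Coherent : PMap VN → Set
  Coherent P = (A : VN) → P ≤P ρ A P

  InF : PMap VN → Set
  InF P = Coherent P × ((B : VN) → P B ≡ r Fin.zero P B)

-- The sweep r₀ applies ρ to the nonterminals 0, 1, …, n in turn, and after
-- nonterminal i has been updated no later step touches it again.  Hence if P is
-- the result of sweeping P, every intermediate map of the sweep already equals
-- P, and P i is the value g (Pexp i) computed from such a map, i.e. from P
-- itself.  So P is a fixed point of every ρ(A, ·).
module Submission where

open import Defs
open import Data.Nat using (ℕ; zero; suc; _≤_; _<_; _+_; _≡ᵇ_; z≤n; s≤s)
open import Data.Nat.Properties
  using (≡ᵇ⇒≡; ≡⇒≡ᵇ; _≟_; ≤-reflexive; ≤-antisym; <⇒≢; ≤∧≢⇒<; m<n⇒m<1+n; +-identityʳ; +-suc)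
open import Data.Fin using (Fin; toℕ)
open import Data.Fin.Properties using (toℕ≤pred[n])
open import Data.Bool using (true; false)
open import Data.Product using (_,_)
open import Relation.Nullary using (yes; no; contradiction)
open import Relation.Binary.PropositionalEquality
open ≡-Reasoning
open import Function using (_∘_)

g-cong : {VT VN : Set} (e : Exp VT VN) {P Q : PMap VN} → P ≗ Q → g e P ≡ g e Q
g-cong ε         P≗Q = refl
g-cong any       P≗Q = refl
g-cong (term a)  P≗Q = refl
g-cong (nt A)    P≗Q = P≗Q A
g-cong (e₁ ︔ e₂) P≗Q rewrite g-cong e₁ P≗Q | g-cong e₂ P≗Q = refl
g-cong (e₁ ／ e₂) P≗Q rewrite g-cong e₁ P≗Q | g-cong e₂ P≗Q = refl
g-cong (e ⋆)     P≗Q rewrite g-cong e P≗Q = refl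
g-cong (! e)     P≗Q rewrite g-cong e P≗Q = refl

module Sweep {VT : Set} (n : ℕ) (Pexp : Fin (suc n) → Exp VT (Fin (suc n))) where
  open PEG n Pexp

  ρℕ-updated : ∀ i Q B → toℕ B ≡ i → ρℕ i Q B ≡ g (Pexp B) Q
  ρℕ-updated i Q B B≡i with toℕ B ≡ᵇ i | ≡⇒≡ᵇ (toℕ B) i B≡i
  ... | true | _ = refl

  ρℕ-unchanged : ∀ i Q B → toℕ B ≢ i → ρℕ i Q B ≡ Q B
  ρℕ-unchanged i Q B B≢i with toℕ B ≡ᵇ i | ≡ᵇ⇒≡ (toℕ B) i
  ... | true  | B≡i = contradiction (B≡i _) B≢i
  ... | false | _   = refl

  rAux-below : ∀ m i Q B → toℕ B < i → rAux m i Q B ≡ Q B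
  rAux-below zero    i Q B B<i = ρℕ-unchanged i Q B (<⇒≢ B<i)
  rAux-below (suc m) i Q B B<i =
    trans (rAux-below m (suc i) (ρℕ i Q) B (m<n⇒m<1+n B<i)) (ρℕ-unchanged i Q B (<⇒≢ B<i))

  rAux-at : ∀ m i Q B → toℕ B ≡ i → rAux m i Q B ≡ ρℕ i Q B
  rAux-at zero    i Q B B≡i = refl
  rAux-at (suc m) i Q B B≡i = rAux-below m (suc i) (ρℕ i Q) B (s≤s (≤-reflexive B≡i))

  module _ (P : PMap VN) where

    rAux-step-preserves : ∀ m i Q → Q ≗ P → P ≗ rAux (suc m) i Q → ρℕ i Q ≗ P
    rAux-step-preserves m i Q Q≗P P≗r C with toℕ C ≟ i
    ... | yes C≡i = sym (trans (P≗r C) (rAux-at (suc m) i Q C C≡i))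
    ... | no  C≢i = trans (ρℕ-unchanged i Q C C≢i) (Q≗P C)

    rAux-fixed⇒g-fixed : ∀ m i Q → Q ≗ P → P ≗ rAux m i Q →
                         ∀ B → i ≤ toℕ B → toℕ B ≤ i + m → P B ≡ g (Pexp B) P
    rAux-fixed⇒g-fixed m i Q Q≗P P≗r B i≤B B≤i+m with toℕ B ≟ i
    ... | yes B≡i = begin
      P B              ≡⟨ P≗r B ⟩
      rAux m i Q B     ≡⟨ rAux-at m i Q B B≡i ⟩
      ρℕ i Q B         ≡⟨ ρℕ-updated i Q B B≡i ⟩
      g (Pexp B) Q     ≡⟨ g-cong (Pexp B) Q≗P ⟩
      g (Pexp B) P     ∎
    rAux-fixed⇒g-fixed zero i Q Q≗P P≗r B i≤B B≤i | no B≢i =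
      contradiction (≤-antisym (subst (toℕ B ≤_) (+-identityʳ i) B≤i) i≤B) B≢i
    rAux-fixed⇒g-fixed (suc m) i Q Q≗P P≗r B i≤B B≤i+m | no B≢i =
      rAux-fixed⇒g-fixed m (suc i) (ρℕ i Q) (rAux-step-preserves m i Q Q≗P P≗r) P≗r B
        (≤∧≢⇒< i≤B (B≢i ∘ sym)) (subst (toℕ B ≤_) (+-suc i m) B≤i+m)

    r₀-fixed⇒g-fixed : P ≗ r Fin.zero P → ∀ B → P B ≡ g (Pexp B) P
    r₀-fixed⇒g-fixed P≗r₀ B = rAux-fixed⇒g-fixed n 0 P (λ _ → refl) P≗r₀ B z≤n (toℕ≤pred[n] B)

    g-fixed⇒ρ-fixed : (∀ B → P B ≡ g (Pexp B) P) → ∀ A → P ≗ ρ A P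
    g-fixed⇒ρ-fixed P≡gP A B with toℕ B ≟ toℕ A
    ... | yes B≡A = trans (P≡gP B) (sym (ρℕ-updated (toℕ A) P B B≡A))
    ... | no  B≢A = sym (ρℕ-unchanged (toℕ A) P B B≢A)

theorem3p3 : {VT : Set} (n : ℕ) (Pexp : Fin (suc n) → Exp VT (Fin (suc n)))
    → (P : PMap (Fin (suc n))) → PEG.InF n Pexp P
    → (A B : Fin (suc n)) → P B ≡ PEG.ρ n Pexp A P B
theorem3p3 n Pexp P (_ , P≗r₀) =
  g-fixed⇒ρ-fixed P (r₀-fixed⇒g-fixed P P≗r₀)
  where open Sweep n Pexp
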